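{- Let $\mathcal{S}$ be a positive signature. The relation $\preccurlyeq$ on the set of reduced $\mathcal{S}$-forests, defined as the reflexive and transitive closure of the relation $\rightharpoonup$, is a partial order. Moreover, $\rightharpoonup$ is the covering relation of this partial order.
   Context: A signature is a graded set $\mathcal{S}=\bigsqcup_{n\ge 0}\mathcal{S}(n)$ (elements of $\mathcal{S}(n)$ have arity $n$); it is positive if $\mathcal{S}(0)=\emptyset$. An $\mathcal{S}$-term is either the leaf $\perp$ or a pair $(\mathsf{g},(\mathfrak{t}_1,\dots,\mathfrak{t}_n))$ with $\mathsf{g}\in\mathcal{S}(n)$ and $\mathfrak{t}_1,\dots,\mathfrak{t}_n$ $\mathcal{S}$-terms, i.e. a planar rooted tree whose internal nodes are decorated by elements of $\mathcal{S}$, an internal node decorated by $\mathsf{g}\in\mathcal{S}(n)$ having exactly $n$ ordered children (each an internal node or a leaf). An $\mathcal{S}$-forest is a finite word of $\mathcal{S}$-terms; it is reduced if none of its terms is the leaf $\perp$. The relation $\rightharpoonup$ on reduced $\mathcal{S}$-forests is defined by $\mathfrak{f}\rightharpoonup\mathfrak{f}'$ if $\mathfrak{f}'$ is obtained from $\mathfrak{f}$ by selecting an internal node $i$, detaching the subterm rooted at $i$, and grafting it onto the rightmost leaf of its former immediate left brother. Here the immediate left brother of $i$ is the subterm (possibly a single leaf $\perp$) immediately to the left of the subterm rooted at $i$ among the children of the parent of $i$, or, when $i$ is the root of a term of the forest, the term of the forest immediately to its left; when $i$ is not a root, a leaf is left in its former place, and when $i$ is a root, its term is removed from the forest; the rightmost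 leaf of a leaf is itself. -}

module Defs where

open import Data.Nat using (ℕ; zero; suc)
open import Data.Vec using (Vec; []; _∷_; _∷ʳ_)
open import Data.List using (List; []; _∷_)
open import Data.List.Relation.Unary.All using (All)
open import Data.Product using (Σ; _×_; _,_; proj₁)
open import Relation.Nullary using (¬_)
open import Relation.Binary.PropositionalEquality using (_≡_)
open import Relation.Binary.Construct.Closure.ReflexiveTransitive using (Star)

Signature : Set₁
Signature = ℕ → Set

Positive : Signature → Set
Positive S = ¬ S 0

module _ (S : Signature) where

  data Term : Set where
    leaf : Term
    node : {n : ℕ} → S n → Vec Term n → Term

  data IsNode : Term → Set where
    isNode : {n : ℕ} {g : S n} {ts : Vec Term n} → IsNode (node g ts)

  Forest : Set
  Forest = List Term

  Reduced : Forest → Set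
  Reduced f = All IsNode f

  ReducedForest : Set
  ReducedForest = Σ Forest Reduced

  -- Graft t u r : r is u with t grafted onto the rightmost leaf of u
  -- (the rightmost leaf of a leaf is itself).
  data Graft (t : Term) : Term → Term → Set where
    graft-leaf : Graft t leaf t
    graft-node : {k : ℕ} {g : S (suc k)} {xs : Vec Term k} {x r : Term} →
                 Graft t x r → Graft t (node g (xs ∷ʳ x)) (node g (xs ∷ʳ r))

  mutual
    -- a move at an internal node that is not the root of the term
    data TermStep : Term → Term → Set where
      inside : {n : ℕ} {g : S n} {ts ts' : Vec Term n} →
               ChildStep ts ts' → TermStep (node g ts) (node g ts')

    data ChildStep : {n : ℕ} → Vec Term n → Vec Term n → Set where
      here  : {n : ℕ} {u t r : Term} {rest : Vec Term n} →
              IsNode t → Graft t u r →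
              ChildStep (u ∷ t ∷ rest) (r ∷ leaf ∷ rest)
      deep  : {n : ℕ} {t t' : Term} {rest : Vec Term n} →
              TermStep t t' → ChildStep (t ∷ rest) (t' ∷ rest)
      there : {n : ℕ} {x : Term} {rest rest' : Vec Term n} →
              ChildStep rest rest' → ChildStep (x ∷ rest) (x ∷ rest')

  -- the relation ⇀ on forests: the move at a root removes the term from the forest
  data ForestStep : Forest → Forest → Set where
    here  : {u t r : Term} {rest : Forest} →
            IsNode t → Graft t u r → ForestStep (u ∷ t ∷ rest) (r ∷ rest)
    deep  : {t t' : Term} {rest : Forest} →
            TermStep t t' → ForestStep (t ∷ rest) (t' ∷ rest)
    there : {x : Term} {rest rest' : Forest} →
            ForestStep rest rest' → ForestStep (x ∷ rest) (x ∷ rest')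

  _⇀_ : ReducedForest → ReducedForest → Set
  f ⇀ g = ForestStep (proj₁ f) (proj₁ g)

  _≈_ : ReducedForest → ReducedForest → Set
  f ≈ g = proj₁ f ≡ proj₁ g

  _≼_ : ReducedForest → ReducedForest → Set
  _≼_ = Star _⇀_

Covers : {A : Set} → (A → A → Set) → (A → A → Set) → A → A → Set
Covers _≈_ _≤_ x y =
  (x ≤ y × ¬ (x ≈ y)) ×
  ¬ (Σ _ λ z → (x ≤ z × ¬ (x ≈ z)) × (z ≤ y × ¬ (z ≈ y)))

module Submission where

-- Number the leaves of a forest from left to right and label every internal node by the position
-- of its leftmost leaf, and by its span, the number of nodes whose positions move with it.  A move
-- grafts a subterm onto the rightmost leaf of its left brother, one position further left; so the
-- nodes of the moved subterm (and, for a root, of the rest of the forest) form an interval in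
-- preorder whose positions all drop by exactly one, while every other position is unchanged.
-- Positions never increase, which gives antisymmetry.  For the covering property, suppose x ⇀ y
-- moves the block B and x ⇀⁺ z ⇀⁺ y.  Between x and y only positions in B drop, each by one.  The
-- step of the chain that first lowers the first node p of B moves p itself, and the span of p has
-- not shrunk before it, so that step lowers all of B; the first node moved by any other step of the
-- chain also lies in B and is therefore lowered twice — a contradiction.

open import Defs
open import Data.Empty using (⊥; ⊥-elim)
open import Data.List using (List; []; _∷_; _++_; length)
open import Data.List.Properties using (++-assoc; length-++; ++-identityʳ)
open import Data.List.Relation.Binary.Pointwise as Pointwise using (Pointwise; []; _∷_; ++⁺; Pointwise-length)
open import Data.List.Relation.Unary.All as All using ([]; _∷_)
open import Data.Nat using (ℕ; zero; suc; _+_; _≤_; _<_; _≤?_; _<?_; _≟_; s≤s; z<s)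
open import Data.Nat.Properties
open import Data.Product using (∃; ∃₂; _×_; _,_; proj₁; proj₂)
open import Data.Vec using (Vec; []; _∷_; _∷ʳ_)
open import Function using (_∘_)
open import Function.Bundles using (_⇔_; mk⇔)
open import Relation.Binary.Construct.Closure.ReflexiveTransitive using (Star; ε; _◅_; _◅◅_)
open import Relation.Binary.PropositionalEquality
open import Relation.Binary.Structures using (IsPartialOrder)
open import Relation.Nullary using (¬_; Dec; yes; no)
open import Relation.Nullary.Decidable using (_×-dec_)

InBlock : ℕ → ℕ → ℕ → Set
InBlock q m i = q ≤ i × i < q + m

inBlock? : ∀ q m i → Dec (InBlock q m i)
inBlock? q m i = q ≤? i ×-dec i <? q + m

-- a i and s i are the position and the span of the i-th node in preorder; the step lowers the
-- block of s start consecutive nodes beginning at start.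
record BlockDrop (a s a′ s′ : ℕ → ℕ) : Set where
  field
    start        : ℕ
    nonempty     : 0 < s start
    drop-inside  : ∀ {i} → InBlock start (s start) i → a i ≡ suc (a′ i)
    keep-outside : ∀ {i} → ¬ InBlock start (s start) i → a′ i ≡ a i
    span-mono    : ∀ {i} → i ≢ start → s i ≤ s′ i

  drops-at-start : a′ start < a start
  drops-at-start = ≤-reflexive (sym (drop-inside (≤-refl , m<m+n start nonempty)))

  kept-before : ∀ {i} → i < start → a′ i ≡ a i
  kept-before i<start = keep-outside (λ (start≤i , _) → <⇒≱ i<start start≤i)

  antitone : ∀ i → a′ i ≤ a i
  antitone i with inBlock? start (s start) i
  ... | yes i∈B = ≤-trans (n≤1+n _) (≤-reflexive (sym (drop-inside i∈B)))
  ... | no  i∉B = ≤-reflexive (keep-outside i∉B)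

  drops-at-most-one : ∀ i → a i ≤ suc (a′ i)
  drops-at-most-one i with inBlock? start (s start) i
  ... | yes i∈B = ≤-reflexive (drop-inside i∈B)
  ... | no  i∉B = ≤-trans (≤-reflexive (sym (keep-outside i∉B))) (n≤1+n _)

module Descent {X : Set} (_⇒_ : X → X → Set) (pos span : X → ℕ → ℕ)
               (blockDrop : ∀ {x y} → x ⇒ y → BlockDrop (pos x) (span x) (pos y) (span y)) where

  open BlockDrop

  _⇒*_ : X → X → Set
  _⇒*_ = Star _⇒_

  pos-antitone : ∀ {x y} → x ⇒* y → ∀ i → pos y i ≤ pos x i
  pos-antitone ε        i = ≤-refl
  pos-antitone (s ◅ xs) i = ≤-trans (pos-antitone xs i) (antitone (blockDrop s) i)

  pos-drops : ∀ {x x₁ y} → x ⇒ x₁ → x₁ ⇒* y → ∃ λ i → pos y i < pos x i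
  pos-drops s xs = start (blockDrop s) , ≤-<-trans (pos-antitone xs _) (drops-at-start (blockDrop s))

  antisym : ∀ {x y} → x ⇒* y → y ⇒* x → x ≡ y
  antisym ε        _  = refl
  antisym (s ◅ xs) ys with pos-drops s xs
  ... | i , drop = ⊥-elim (<⇒≱ drop (pos-antitone ys i))

  first-drop : ∀ {x y} i → x ⇒* y → pos y i < pos x i →
               ∃₂ λ w w′ → x ⇒* w × w ⇒ w′ × w′ ⇒* y × pos x i ≤ pos w i × pos w′ i < pos w i
  first-drop i ε drop = ⊥-elim (<-irrefl refl drop)
  first-drop {x} i (_◅_ {j = x₁} s xs) drop with pos x₁ i <? pos x i
  ... | yes drop₁ = x , x₁ , ε , s , xs , ≤-refl , drop₁
  ... | no ¬drop₁ with first-drop i xs (<-≤-trans drop (≮⇒≥ ¬drop₁))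
  ...   | w , w′ , ys , s′ , zs , kept , drop′ =
          w , w′ , s ◅ ys , s′ , zs , ≤-trans (≮⇒≥ ¬drop₁) kept , drop′

  span-kept : ∀ {x w} i → x ⇒* w → pos x i ≤ pos w i → span x i ≤ span w i
  span-kept i ε _ = ≤-refl
  span-kept i (s ◅ xs) kept with start (blockDrop s) ≟ i
  ... | yes refl = ⊥-elim (<⇒≱ (≤-<-trans (pos-antitone xs i) (drops-at-start (blockDrop s))) kept)
  ... | no start≢i = ≤-trans (span-mono (blockDrop s) (start≢i ∘ sym))
                             (span-kept i xs (≤-trans (antitone (blockDrop s) i) kept))

  drops-twice : ∀ {x u u′ v v′ y} i → x ⇒* u → u′ ⇒* v → v′ ⇒* y →
                pos u′ i < pos u i → pos v′ i < pos v i → 2 + pos y i ≤ pos x i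
  drops-twice {x} {u} {u′} {v} {v′} {y} i xs ys zs drop₁ drop₂ = begin
    2 + pos y i  ≤⟨ s≤s (s≤s (pos-antitone zs i)) ⟩
    2 + pos v′ i ≤⟨ s≤s drop₂ ⟩
    1 + pos v i  ≤⟨ s≤s (pos-antitone ys i) ⟩
    1 + pos u′ i ≤⟨ drop₁ ⟩
    pos u i      ≤⟨ pos-antitone xs i ⟩
    pos x i      ∎
    where open ≤-Reasoning

  module _ {x y} (step : x ⇒ y) where
    private
      B : BlockDrop (pos x) (span x) (pos y) (span y)
      B = blockDrop step
      p m : ℕ
      p = start B
      m = span x p

    only-block-drops : ∀ {i} → pos y i < pos x i → InBlock p m i
    only-block-drops {i} drop with inBlock? p m i
    ... | yes i∈B = i∈B
    ... | no  i∉B = ⊥-elim (<-irrefl (keep-outside B i∉B) drop)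

    start-in-block : ∀ {u u′} → x ⇒* u → (s : u ⇒ u′) → u′ ⇒* y → InBlock p m (start (blockDrop s))
    start-in-block xs s ys = only-block-drops
      (≤-<-trans (pos-antitone ys _) (<-≤-trans (drops-at-start (blockDrop s)) (pos-antitone xs _)))

    first-drop-lowers-block : ∀ {w w′} → x ⇒* w → (s : w ⇒ w′) → w′ ⇒* y →
                              pos x p ≤ pos w p → pos w′ p < pos w p →
                              ∀ {i} → InBlock p m i → pos w′ i < pos w i
    first-drop-lowers-block xs s ys kept drop {i} (p≤i , i<p+m) =
      ≤-reflexive (sym (drop-inside S i∈S))
      where
      S = blockDrop s
      starts-at-p : start S ≡ p
      starts-at-p = ≤-antisym (≮⇒≥ (λ p<q → <-irrefl (kept-before S p<q) drop))
                              (proj₁ (start-in-block xs s ys))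
      i∈S : InBlock (start S) (span _ (start S)) i
      i∈S = subst (λ q → InBlock q (span _ q) i) (sym starts-at-p)
                  (p≤i , <-≤-trans i<p+m (+-monoʳ-≤ p (span-kept p xs kept)))

    too-low : ∀ {i} → 2 + pos y i ≤ pos x i → ⊥
    too-low {i} le = <-irrefl refl (≤-trans le (drops-at-most-one B i))

    no-longer-path : ∀ {u v v′} → x ⇒ u → u ⇒* v → v ⇒ v′ → v′ ⇒* y → ⊥
    no-longer-path {v = v} s₁ xs s₂ ys with pos v p <? pos x p
    ... | yes drop with first-drop p (s₁ ◅ xs) drop
    ...   | w , w′ , us , s , vs , kept , drop′ = too-low (drops-twice i us vs ys
              (first-drop-lowers-block us s (vs ◅◅ s₂ ◅ ys) kept drop′ (start-in-block (s₁ ◅ xs) s₂ ys))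
              (drops-at-start (blockDrop s₂)))
      where i = start (blockDrop s₂)
    no-longer-path {v = v} s₁ xs s₂ ys | no ¬drop
      with first-drop p (s₂ ◅ ys) (<-≤-trans (drops-at-start B) (≮⇒≥ ¬drop))
    ... | w , w′ , us , s , vs , kept , drop′ = too-low (drops-twice i ε (xs ◅◅ us) vs
              (drops-at-start (blockDrop s₁))
              (first-drop-lowers-block (s₁ ◅ xs ◅◅ us) s vs (≤-trans (≮⇒≥ ¬drop) kept) drop′
                                       (start-in-block ε s₁ (xs ◅◅ s₂ ◅ ys))))
      where i = start (blockDrop s₁)

Label : Set
Label = ℕ × ℕ

infixl 5 _!_
_!_ : List Label → ℕ → Label
[]       ! _     = 0 , 0
(x ∷ xs) ! zero  = x
(x ∷ xs) ! suc i = xs ! i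

posAt spanAt : List Label → ℕ → ℕ
posAt  D i = proj₁ (D ! i)
spanAt D i = proj₂ (D ! i)

Kept Shifted : Label → Label → Set
Kept    x x′ = proj₁ x′ ≡ proj₁ x × proj₂ x ≤ proj₂ x′
Shifted x x′ = proj₁ x ≡ suc (proj₁ x′) × proj₂ x ≤ proj₂ x′

Kept-refl : ∀ {D} → Pointwise Kept D D
Kept-refl = Pointwise.refl (refl , ≤-refl)

-- The list-level shape of a step: the node x at the end of P moves one position left together
-- with the block Q following it, whose length is the span of x.
record Shift (D D′ : List Label) : Set where
  field
    P P′ Q Q′ R : List Label
    x x′        : Label
    D≡          : D ≡ P ++ x ∷ Q ++ R
    D′≡         : D′ ≡ P′ ++ x′ ∷ Q′ ++ R
    P-kept      : Pointwise Kept P P′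
    x-shifted   : proj₁ x ≡ suc (proj₁ x′)
    Q-shifted   : Pointwise Shifted Q Q′
    x-span      : proj₂ x ≡ suc (length Q)

shift-++ˡ : ∀ {Z Z′ D D′} → Pointwise Kept Z Z′ → Shift D D′ → Shift (Z ++ D) (Z′ ++ D′)
shift-++ˡ {Z} {Z′} kept sh = record
  { P = Z ++ P ; P′ = Z′ ++ P′ ; Q = Q ; Q′ = Q′ ; R = R ; x = x ; x′ = x′
  ; D≡ = trans (cong (Z ++_) D≡) (sym (++-assoc Z P _))
  ; D′≡ = trans (cong (Z′ ++_) D′≡) (sym (++-assoc Z′ P′ _))
  ; P-kept = ++⁺ kept P-kept ; x-shifted = x-shifted ; Q-shifted = Q-shifted ; x-span = x-span }
  where open Shift sh

shift-++ʳ : ∀ {D D′} Z → Shift D D′ → Shift (D ++ Z) (D′ ++ Z)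
shift-++ʳ Z sh = record
  { P = P ; P′ = P′ ; Q = Q ; Q′ = Q′ ; R = R ++ Z ; x = x ; x′ = x′
  ; D≡ = trans (cong (_++ Z) D≡) (trans (++-assoc P _ Z) (cong (λ L → P ++ x ∷ L) (++-assoc Q R Z)))
  ; D′≡ = trans (cong (_++ Z) D′≡) (trans (++-assoc P′ _ Z) (cong (λ L → P′ ++ x′ ∷ L) (++-assoc Q′ R Z)))
  ; P-kept = P-kept ; x-shifted = x-shifted ; Q-shifted = Q-shifted ; x-span = x-span }
  where open Shift sh

!-++ˡ : ∀ X Y {i} → i < length X → (X ++ Y) ! i ≡ X ! i
!-++ˡ (x ∷ X) Y {zero}  _         = refl
!-++ˡ (x ∷ X) Y {suc i} (s≤s i<n) = !-++ˡ X Y i<n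

!-++ʳ : ∀ X Y j → (X ++ Y) ! (length X + j) ≡ Y ! j
!-++ʳ []      Y j = refl
!-++ʳ (x ∷ X) Y j = !-++ʳ X Y j

Pointwise-! : ∀ {_∼_ : Label → Label → Set} {X Y} → Pointwise _∼_ X Y →
              ∀ {i} → i < length X → (X ! i) ∼ (Y ! i)
Pointwise-! (r ∷ _)  {zero}  _         = r
Pointwise-! (_ ∷ rs) {suc i} (s≤s i<n) = Pointwise-! rs i<n

data Region (q m : ℕ) : ℕ → Set where
  before : ∀ {i} → i < q → Region q m i
  first  : Region q m q
  within : ∀ {j} → j < m → Region q m (q + suc j)
  after  : ∀ j → Region q m (q + suc (m + j))

region : ∀ q m i → Region q m i
region zero    m zero    = first
region zero    m (suc i) = below m i
  where
  below : ∀ m i → Region 0 m (suc i)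
  below zero    i       = after i
  below (suc m) zero    = within z<s
  below (suc m) (suc i) with below m i
  ... | within j<m = within (s≤s j<m)
  ... | after j    = after j
region (suc q) m zero    = before z<s
region (suc q) m (suc i) with region q m i
... | before i<q = before (s≤s i<q)
... | first      = first
... | within j<m = within j<m
... | after j    = after j

module ShiftAt {D D′ : List Label} (sh : Shift D D′) where
  open Shift sh

  q m : ℕ
  q = length P
  m = length Q

  |P′|≡q : length P′ ≡ q
  |P′|≡q = sym (Pointwise-length P-kept)

  |Q′|≡m : length Q′ ≡ m
  |Q′|≡m = sym (Pointwise-length Q-shifted)

  D-from-q : ∀ k → D ! (q + k) ≡ (x ∷ Q ++ R) ! k
  D-from-q k rewrite D≡ = !-++ʳ P _ k

  D′-from-q : ∀ k → D′ ! (q + k) ≡ (x′ ∷ Q′ ++ R) ! k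
  D′-from-q k rewrite D′≡ | sym |P′|≡q = !-++ʳ P′ _ k

  at-before : ∀ {i} → i < q → Kept (D ! i) (D′ ! i)
  at-before {i} i<q rewrite D≡ | D′≡ | !-++ˡ P (x ∷ Q ++ R) i<q
                          | !-++ˡ P′ (x′ ∷ Q′ ++ R) (subst (i <_) (sym |P′|≡q) i<q) = Pointwise-! P-kept i<q

  at-within : ∀ {j} → j < m → Shifted (D ! (q + suc j)) (D′ ! (q + suc j))
  at-within {j} j<m rewrite D-from-q (suc j) | D′-from-q (suc j) | !-++ˡ Q R j<m
                          | !-++ˡ Q′ R (subst (j <_) (sym |Q′|≡m) j<m) = Pointwise-! Q-shifted j<m

  at-after : ∀ j → D′ ! (q + suc (m + j)) ≡ D ! (q + suc (m + j))
  at-after j rewrite D-from-q (suc (m + j)) | D′-from-q (suc (m + j)) | !-++ʳ Q R j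
               | sym |Q′|≡m | !-++ʳ Q′ R j = refl

  D-at-q : D ! q ≡ x
  D-at-q = trans (cong (D !_) (sym (+-identityʳ q))) (D-from-q 0)

  D′-at-q : D′ ! q ≡ x′
  D′-at-q = trans (cong (D′ !_) (sym (+-identityʳ q))) (D′-from-q 0)

  span-q : spanAt D q ≡ suc m
  span-q = trans (cong proj₂ D-at-q) x-span

shift⇒blockDrop : ∀ {D D′} → Shift D D′ → BlockDrop (posAt D) (spanAt D) (posAt D′) (spanAt D′)
shift⇒blockDrop {D} {D′} sh = record
  { start = q ; nonempty = subst (0 <_) (sym span-q) z<s
  ; drop-inside = drops-in-block ; keep-outside = kept-off-block ; span-mono = spans-grow }
  where
  open Shift sh
  open ShiftAt sh

  to-block : ∀ {i} → InBlock q (suc m) i → InBlock q (spanAt D q) i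
  to-block {i} = subst (λ n → InBlock q n i) (sym span-q)

  from-block : ∀ {i} → InBlock q (spanAt D q) i → InBlock q (suc m) i
  from-block {i} = subst (λ n → InBlock q n i) span-q

  drops-in-block : ∀ {i} → InBlock q (spanAt D q) i → posAt D i ≡ suc (posAt D′ i)
  drops-in-block {i} i∈B with region q m i | from-block i∈B
  ... | before i<q | q≤i , _   = ⊥-elim (<⇒≱ i<q q≤i)
  ... | first      | _         = trans (cong proj₁ D-at-q) (trans x-shifted (cong (suc ∘ proj₁) (sym D′-at-q)))
  ... | within j<m | _         = proj₁ (at-within j<m)
  ... | after j    | _ , i<end = ⊥-elim (<⇒≱ (+-cancelˡ-< q _ _ i<end) (s≤s (m≤m+n m j)))

  kept-off-block : ∀ {i} → ¬ InBlock q (spanAt D q) i → posAt D′ i ≡ posAt D i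
  kept-off-block {i} i∉B with region q m i
  ... | before i<q = proj₁ (at-before i<q)
  ... | first      = ⊥-elim (i∉B (to-block (≤-refl , m<m+n q z<s)))
  ... | within j<m = ⊥-elim (i∉B (to-block (m≤m+n q _ , +-monoʳ-< q (s≤s j<m))))
  ... | after j    = cong proj₁ (at-after j)

  spans-grow : ∀ {i} → i ≢ q → spanAt D i ≤ spanAt D′ i
  spans-grow {i} i≢q with region q m i
  ... | before i<q = proj₂ (at-before i<q)
  ... | first      = ⊥-elim (i≢q refl)
  ... | within j<m = proj₂ (at-within j<m)
  ... | after j    = ≤-reflexive (cong proj₂ (sym (at-after j)))

module Labelling (S : Signature) where

  mutual
    leaves : Term S → ℕ
    leaves leaf        = 1
    leaves (node _ ts) = leavesᵛ ts

    leavesᵛ : ∀ {n} → Vec (Term S) n → ℕ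
    leavesᵛ []       = 0
    leavesᵛ (t ∷ ts) = leaves t + leavesᵛ ts

  mutual
    nodes : Term S → ℕ
    nodes leaf        = 0
    nodes (node _ ts) = suc (nodesᵛ ts)

    nodesᵛ : ∀ {n} → Vec (Term S) n → ℕ
    nodesᵛ []       = 0
    nodesᵛ (t ∷ ts) = nodes t + nodesᵛ ts

  nodesᶠ : Forest S → ℕ
  nodesᶠ []      = 0
  nodesᶠ (t ∷ f) = nodes t + nodesᶠ f

  mutual
    labels : ℕ → Term S → List Label
    labels o leaf        = []
    labels o (node _ ts) = (o , suc (nodesᵛ ts)) ∷ labelsᵛ o ts

    labelsᵛ : ∀ {n} → ℕ → Vec (Term S) n → List Label
    labelsᵛ o []       = []
    labelsᵛ o (t ∷ ts) = labels o t ++ labelsᵛ (o + leaves t) ts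

  withSpan : ℕ → List Label → List Label
  withSpan n []            = []
  withSpan n ((a , _) ∷ D) = (a , n) ∷ D

  -- The span of a root is the number of nodes from it to the end of the forest: moving a root
  -- shifts all of them, since no leaf is left in its place.
  labelsᶠ : ℕ → Forest S → List Label
  labelsᶠ o []      = []
  labelsᶠ o (t ∷ f) = withSpan (nodes t + nodesᶠ f) (labels o t) ++ labelsᶠ (o + leaves t) f

  leavesᵛ-∷ʳ : ∀ {n} (ts : Vec (Term S) n) t → leavesᵛ (ts ∷ʳ t) ≡ leavesᵛ ts + leaves t
  leavesᵛ-∷ʳ []       t = +-identityʳ _
  leavesᵛ-∷ʳ (u ∷ ts) t = trans (cong (leaves u +_) (leavesᵛ-∷ʳ ts t)) (sym (+-assoc (leaves u) _ _))

  nodesᵛ-∷ʳ : ∀ {n} (ts : Vec (Term S) n) t → nodesᵛ (ts ∷ʳ t) ≡ nodesᵛ ts + nodes t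
  nodesᵛ-∷ʳ []       t = +-identityʳ _
  nodesᵛ-∷ʳ (u ∷ ts) t = trans (cong (nodes u +_) (nodesᵛ-∷ʳ ts t)) (sym (+-assoc (nodes u) _ _))

  labelsᵛ-∷ʳ : ∀ {n} o (ts : Vec (Term S) n) t → labelsᵛ o (ts ∷ʳ t) ≡ labelsᵛ o ts ++ labels (o + leavesᵛ ts) t
  labelsᵛ-∷ʳ o []       t = trans (++-identityʳ _) (cong (λ o′ → labels o′ t) (sym (+-identityʳ o)))
  labelsᵛ-∷ʳ o (u ∷ ts) t = begin
    labels o u ++ labelsᵛ (o + leaves u) (ts ∷ʳ t)
      ≡⟨ cong (labels o u ++_) (labelsᵛ-∷ʳ (o + leaves u) ts t) ⟩
    labels o u ++ labelsᵛ (o + leaves u) ts ++ labels (o + leaves u + leavesᵛ ts) t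
      ≡⟨ sym (++-assoc (labels o u) _ _) ⟩
    (labels o u ++ labelsᵛ (o + leaves u) ts) ++ labels (o + leaves u + leavesᵛ ts) t
      ≡⟨ cong (λ o′ → (labels o u ++ labelsᵛ (o + leaves u) ts) ++ labels o′ t) (+-assoc o (leaves u) _) ⟩
    (labels o u ++ labelsᵛ (o + leaves u) ts) ++ labels (o + (leaves u + leavesᵛ ts)) t ∎
    where open ≡-Reasoning

  mutual
    length-labels : ∀ o t → length (labels o t) ≡ nodes t
    length-labels o leaf        = refl
    length-labels o (node _ ts) = cong suc (length-labelsᵛ o ts)

    length-labelsᵛ : ∀ {n} o (ts : Vec (Term S) n) → length (labelsᵛ o ts) ≡ nodesᵛ ts
    length-labelsᵛ o []       = refl
    length-labelsᵛ o (t ∷ ts) =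
      trans (length-++ (labels o t)) (cong₂ _+_ (length-labels o t) (length-labelsᵛ (o + leaves t) ts))

  length-withSpan : ∀ n D → length (withSpan n D) ≡ length D
  length-withSpan n []      = refl
  length-withSpan n (_ ∷ _) = refl

  length-labelsᶠ : ∀ o f → length (labelsᶠ o f) ≡ nodesᶠ f
  length-labelsᶠ o []      = refl
  length-labelsᶠ o (t ∷ f) = trans (length-++ (withSpan _ (labels o t)))
    (cong₂ _+_ (trans (length-withSpan _ (labels o t)) (length-labels o t)) (length-labelsᶠ (o + leaves t) f))

  mutual
    labels-shifted : ∀ o t → Pointwise Shifted (labels (suc o) t) (labels o t)
    labels-shifted o leaf        = []
    labels-shifted o (node _ ts) = (refl , ≤-refl) ∷ labelsᵛ-shifted o ts

    labelsᵛ-shifted : ∀ {n} o (ts : Vec (Term S) n) → Pointwise Shifted (labelsᵛ (suc o) ts) (labelsᵛ o ts)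
    labelsᵛ-shifted o []       = []
    labelsᵛ-shifted o (t ∷ ts) = ++⁺ (labels-shifted o t) (labelsᵛ-shifted (o + leaves t) ts)

  withSpan-shifted : ∀ n {D D′} → Pointwise Shifted D D′ → Pointwise Shifted (withSpan n D) (withSpan n D′)
  withSpan-shifted n []                 = []
  withSpan-shifted n ((a≡ , _) ∷ D∼D′) = (a≡ , ≤-refl) ∷ D∼D′

  labelsᶠ-shifted : ∀ o f → Pointwise Shifted (labelsᶠ (suc o) f) (labelsᶠ o f)
  labelsᶠ-shifted o []      = []
  labelsᶠ-shifted o (t ∷ f) = ++⁺ (withSpan-shifted _ (labels-shifted o t)) (labelsᶠ-shifted (o + leaves t) f)

  withSpan-kept : ∀ {n n′ D D′} → n ≤ n′ → Pointwise Kept D D′ → Pointwise Kept (withSpan n D) (withSpan n′ D′)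
  withSpan-kept n≤n′ []               = []
  withSpan-kept n≤n′ ((a≡ , _) ∷ D∼D′) = (a≡ , n≤n′) ∷ D∼D′

  withSpan-++ : ∀ n {D} E → 0 < length D → withSpan n (D ++ E) ≡ withSpan n D ++ E
  withSpan-++ n {_ ∷ _} E _ = refl

  record Grafted (t u r : Term S) : Set where
    field
      rightmost : ℕ
      leaves-u  : leaves u ≡ suc rightmost
      leaves-r  : leaves r ≡ rightmost + leaves t
      nodes-r   : nodes r ≡ nodes u + nodes t
      prefix    : ℕ → List Label
      u-kept    : ∀ o → Pointwise Kept (labels o u) (prefix o)
      labels-r  : ∀ o → labels o r ≡ prefix o ++ labels (o + rightmost) t

  grafted : ∀ {t u r} → Graft S t u r → Grafted t u r
  grafted {t} graft-leaf = record
    { rightmost = 0 ; leaves-u = refl ; leaves-r = refl ; nodes-r = refl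
    ; prefix = λ _ → [] ; u-kept = λ _ → []
    ; labels-r = λ o → cong (λ o′ → labels o′ t) (sym (+-identityʳ o)) }
  grafted {t} (graft-node {xs = xs} {x = x} {r = r} x→r) = record
    { rightmost = leavesᵛ xs + rightmost
    ; leaves-u = trans (leavesᵛ-∷ʳ xs x) (trans (cong (leavesᵛ xs +_) leaves-u) (+-suc _ _))
    ; leaves-r = trans (leavesᵛ-∷ʳ xs r)
                       (trans (cong (leavesᵛ xs +_) leaves-r) (sym (+-assoc (leavesᵛ xs) rightmost (leaves t))))
    ; nodes-r = cong suc nodes-xs∷ʳr
    ; prefix = λ o → (o , suc (nodesᵛ (xs ∷ʳ r))) ∷ labelsᵛ o xs ++ prefix (o + leavesᵛ xs)
    ; u-kept = λ o → (refl , s≤s (≤-trans (m≤m+n _ (nodes t)) (≤-reflexive (sym nodes-xs∷ʳr))))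
                     ∷ subst (λ D → Pointwise Kept D (labelsᵛ o xs ++ prefix (o + leavesᵛ xs)))
                             (sym (labelsᵛ-∷ʳ o xs x)) (++⁺ Kept-refl (u-kept (o + leavesᵛ xs)))
    ; labels-r = λ o → cong (_ ∷_) (begin
        labelsᵛ o (xs ∷ʳ r)
          ≡⟨ labelsᵛ-∷ʳ o xs r ⟩
        labelsᵛ o xs ++ labels (o + leavesᵛ xs) r
          ≡⟨ cong (labelsᵛ o xs ++_) (labels-r (o + leavesᵛ xs)) ⟩
        labelsᵛ o xs ++ prefix (o + leavesᵛ xs) ++ labels (o + leavesᵛ xs + rightmost) t
          ≡⟨ sym (++-assoc (labelsᵛ o xs) _ _) ⟩
        (labelsᵛ o xs ++ prefix (o + leavesᵛ xs)) ++ labels (o + leavesᵛ xs + rightmost) t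
          ≡⟨ cong (λ o′ → (labelsᵛ o xs ++ prefix (o + leavesᵛ xs)) ++ labels o′ t) (+-assoc o _ _) ⟩
        (labelsᵛ o xs ++ prefix (o + leavesᵛ xs)) ++ labels (o + (leavesᵛ xs + rightmost)) t ∎) }
    where
    open Grafted (grafted x→r)
    open ≡-Reasoning
    nodes-xs∷ʳr : nodesᵛ (xs ∷ʳ r) ≡ nodesᵛ (xs ∷ʳ x) + nodes t
    nodes-xs∷ʳr = begin
      nodesᵛ (xs ∷ʳ r)               ≡⟨ nodesᵛ-∷ʳ xs r ⟩
      nodesᵛ xs + nodes r            ≡⟨ cong (nodesᵛ xs +_) nodes-r ⟩
      nodesᵛ xs + (nodes x + nodes t) ≡⟨ sym (+-assoc (nodesᵛ xs) _ _) ⟩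
      nodesᵛ xs + nodes x + nodes t   ≡⟨ cong (_+ nodes t) (sym (nodesᵛ-∷ʳ xs x)) ⟩
      nodesᵛ (xs ∷ʳ x) + nodes t      ∎

  module _ {t u r : Term S} (t↝u : Graft S t u r) where
    open Grafted (grafted t↝u)

    graft-nodes : ∀ n → nodes u + (nodes t + n) ≡ nodes r + n
    graft-nodes n = trans (sym (+-assoc (nodes u) (nodes t) n)) (cong (_+ n) (sym nodes-r))

    graft-leaves : leaves u + leaves t ≡ suc (leaves r)
    graft-leaves = trans (cong (_+ leaves t) leaves-u) (cong suc (sym leaves-r))

    graft-offset : ∀ o → o + leaves u + leaves t ≡ suc (o + leaves r)
    graft-offset o = trans (+-assoc o (leaves u) (leaves t)) (trans (cong (o +_) graft-leaves) (+-suc o (leaves r)))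

    graft-moves-left : ∀ o → o + leaves u ≡ suc (o + rightmost)
    graft-moves-left o = trans (cong (o +_) leaves-u) (+-suc o rightmost)

    moved-shifted : ∀ {n} (vs : Vec (Term S) n) o →
                    Pointwise Shifted (labelsᵛ (o + leaves u) vs) (labelsᵛ (o + rightmost) vs)
    moved-shifted vs o = subst (λ o′ → Pointwise Shifted (labelsᵛ o′ vs) (labelsᵛ (o + rightmost) vs))
                               (sym (graft-moves-left o)) (labelsᵛ-shifted (o + rightmost) vs)

    withSpan-grafted : IsNode S u → ∀ n o → withSpan n (labels o r) ≡ withSpan n (prefix o) ++ labels (o + rightmost) t
    withSpan-grafted isNode n o =
      trans (cong (withSpan n) (labels-r o)) (withSpan-++ n {prefix o} _ (subst (0 <_) (Pointwise-length (u-kept o)) z<s))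

  mutual
    termStep-leaves : ∀ {t t′} → TermStep S t t′ → leaves t ≡ leaves t′
    termStep-leaves (inside ts→ts′) = childStep-leaves ts→ts′

    childStep-leaves : ∀ {n} {ts ts′ : Vec (Term S) n} → ChildStep S ts ts′ → leavesᵛ ts ≡ leavesᵛ ts′
    childStep-leaves (here {u = u} {t = t} {r = r} {rest = rest} _ t↝u) = begin
      leaves u + (leaves t + leavesᵛ rest) ≡⟨ sym (+-assoc (leaves u) (leaves t) _) ⟩
      leaves u + leaves t + leavesᵛ rest   ≡⟨ cong (_+ leavesᵛ rest) (graft-leaves t↝u) ⟩
      suc (leaves r) + leavesᵛ rest        ≡⟨ sym (+-suc (leaves r) _) ⟩
      leaves r + suc (leavesᵛ rest)        ∎
      where open ≡-Reasoning
    childStep-leaves (deep t→t′)             = cong (_+ _) (termStep-leaves t→t′)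
    childStep-leaves (there {x = x} ts→ts′) = cong (leaves x +_) (childStep-leaves ts→ts′)

  mutual
    termStep-nodes : ∀ {t t′} → TermStep S t t′ → nodes t ≡ nodes t′
    termStep-nodes (inside ts→ts′) = cong suc (childStep-nodes ts→ts′)

    childStep-nodes : ∀ {n} {ts ts′ : Vec (Term S) n} → ChildStep S ts ts′ → nodesᵛ ts ≡ nodesᵛ ts′
    childStep-nodes (here _ t↝u)             = graft-nodes t↝u _
    childStep-nodes (deep t→t′)             = cong (_+ _) (termStep-nodes t→t′)
    childStep-nodes (there {x = x} ts→ts′) = cong (nodes x +_) (childStep-nodes ts→ts′)

  forestStep-nodes : ∀ {f g} → ForestStep S f g → nodesᶠ f ≡ nodesᶠ g
  forestStep-nodes (here _ t↝u)           = graft-nodes t↝u _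
  forestStep-nodes (deep t→t′)           = cong (_+ _) (termStep-nodes t→t′)
  forestStep-nodes (there {x = x} f→f′) = cong (nodes x +_) (forestStep-nodes f→f′)

  mutual
    termStep-shift : ∀ {t t′} → TermStep S t t′ → ∀ o → Shift (labels o t) (labels o t′)
    termStep-shift (inside ts→ts′) o =
      shift-++ˡ ((refl , ≤-reflexive (cong suc (childStep-nodes ts→ts′))) ∷ []) (childStep-shift ts→ts′ o)

    childStep-shift : ∀ {n} {ts ts′ : Vec (Term S) n} → ChildStep S ts ts′ →
                      ∀ o → Shift (labelsᵛ o ts) (labelsᵛ o ts′)
    childStep-shift (here {u = u} {t = node _ vs} {r = r} {rest = rest} isNode t↝u) o = record
      { P = labels o u ; P′ = prefix o
      ; Q = labelsᵛ (o + leaves u) vs ; Q′ = labelsᵛ (o + rightmost) vs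
      ; R = labelsᵛ (o + leaves u + leavesᵛ vs) rest
      ; x = o + leaves u , suc (nodesᵛ vs) ; x′ = o + rightmost , suc (nodesᵛ vs)
      ; D≡ = refl
      ; D′≡ = trans (cong₂ _++_ (labels-r o) (cong (λ o′ → labelsᵛ o′ rest) leaf-offset))
                    (++-assoc (prefix o) _ _)
      ; P-kept = u-kept o
      ; x-shifted = graft-moves-left t↝u o
      ; Q-shifted = moved-shifted t↝u vs o
      ; x-span = cong suc (sym (length-labelsᵛ _ vs)) }
      where
      open Grafted (grafted t↝u)
      -- the leaf left in place of the moved subterm keeps the positions of rest unchanged
      leaf-offset : o + leaves r + 1 ≡ o + leaves u + leavesᵛ vs
      leaf-offset = trans (+-comm _ 1) (sym (graft-offset t↝u o))
    childStep-shift (deep t→t′) o rewrite termStep-leaves t→t′ =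
      shift-++ʳ _ (termStep-shift t→t′ o)
    childStep-shift (there {x = x} ts→ts′) o = shift-++ˡ Kept-refl (childStep-shift ts→ts′ (o + leaves x))

  forestStep-shift : ∀ {f g} → Reduced S f → ForestStep S f g → ∀ o → Shift (labelsᶠ o f) (labelsᶠ o g)
  forestStep-shift (isNode ∷ isNode {ts = vs} ∷ _) (here {u = u} {t = t} {r = r} {rest = rest} _ t↝u) o =
    record
      { P = withSpan (nodes u + n) (labels o u) ; P′ = withSpan (nodes r + nodesᶠ rest) (prefix o)
      ; Q = Q ; Q′ = Q′ ; R = []
      ; x = o + leaves u , n ; x′ = o + rightmost , suc (nodesᵛ vs)
      ; D≡ = cong (λ L → withSpan (nodes u + n) (labels o u) ++ (o + leaves u , n) ∷ L) (sym (++-identityʳ Q))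
      ; D′≡ = trans (cong (_++ labelsᶠ (o + leaves r) rest) (withSpan-grafted t↝u isNode _ o))
                    (trans (++-assoc (withSpan _ (prefix o)) _ _)
                           (cong (λ L → withSpan _ (prefix o) ++ _ ∷ L) (sym (++-identityʳ Q′))))
      ; P-kept = withSpan-kept (≤-reflexive (graft-nodes t↝u (nodesᶠ rest))) (u-kept o)
      ; x-shifted = graft-moves-left t↝u o
      -- no leaf is left behind, so rest moves one position left as well
      ; Q-shifted = ++⁺ (moved-shifted t↝u vs o)
          (subst (λ o′ → Pointwise Shifted (labelsᶠ o′ rest) (labelsᶠ (o + leaves r) rest))
                 (sym (graft-offset t↝u o)) (labelsᶠ-shifted (o + leaves r) rest))
      ; x-span = cong suc (sym (trans (length-++ (labelsᵛ (o + leaves u) vs))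
                                     (cong₂ _+_ (length-labelsᵛ _ vs) (length-labelsᶠ _ rest)))) }
    where
    open Grafted (grafted t↝u)
    n : ℕ
    n = nodes t + nodesᶠ rest
    Q Q′ : List Label
    Q  = labelsᵛ (o + leaves u) vs ++ labelsᶠ (o + leaves u + leaves t) rest
    Q′ = labelsᵛ (o + rightmost) vs ++ labelsᶠ (o + leaves r) rest
  forestStep-shift _ (deep {rest = rest} (inside {ts = ts} ts→ts′)) o rewrite childStep-leaves ts→ts′ =
    shift-++ˡ ((refl , ≤-reflexive (cong (λ m → suc m + nodesᶠ rest) (childStep-nodes ts→ts′))) ∷ [])
              (shift-++ʳ _ (childStep-shift ts→ts′ o))
  forestStep-shift (_ ∷ f-reduced) (there {x = x} f→f′) o =
    shift-++ˡ (withSpan-kept (≤-reflexive (cong (nodes x +_) (forestStep-nodes f→f′))) Kept-refl)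
              (forestStep-shift f-reduced f→f′ (o + leaves x))

module ForestOrder (S : Signature) where
  open Labelling S

  labelsOf : ReducedForest S → List Label
  labelsOf f = labelsᶠ 0 (proj₁ f)

  ⇀-blockDrop : ∀ {f g} → _⇀_ S f g →
                BlockDrop (posAt (labelsOf f)) (spanAt (labelsOf f)) (posAt (labelsOf g)) (spanAt (labelsOf g))
  ⇀-blockDrop {f} f⇀g = shift⇒blockDrop (forestStep-shift (proj₂ f) f⇀g 0)

  open Descent (_⇀_ S) (posAt ∘ labelsOf) (spanAt ∘ labelsOf) (λ {f} {g} → ⇀-blockDrop {f} {g})

  ⇀⁺⇒≉ : ∀ {f f₁ g} → _⇀_ S f f₁ → _≼_ S f₁ g → ¬ _≈_ S f g
  ⇀⁺⇒≉ {f} {f₁} {g} f⇀f₁ f₁≼g f≈g with pos-drops {f} {f₁} {g} f⇀f₁ f₁≼g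
  ... | i , drop = <-irrefl (cong (λ F → posAt (labelsᶠ 0 F) i) (sym f≈g)) drop

  IsNode-irrelevant : ∀ {t} (p q : IsNode S t) → p ≡ q
  IsNode-irrelevant isNode isNode = refl

  ≈⇒≼ : ∀ {f g} → _≈_ S f g → _≼_ S f g
  ≈⇒≼ {F , p} {.F , q} refl rewrite All.irrelevant IsNode-irrelevant p q = ε

  ≼-isPartialOrder : IsPartialOrder (_≈_ S) (_≼_ S)
  ≼-isPartialOrder = record
    { isPreorder = record
      { isEquivalence = record { refl = refl ; sym = sym ; trans = trans }
      ; reflexive     = ≈⇒≼
      ; trans         = _◅◅_
      }
    ; antisym = λ {f} {g} f≼g g≼f → cong proj₁ (antisym {f} {g} f≼g g≼f)
    }

  ⇀⇔covers : ∀ f g → _⇀_ S f g ⇔ Covers (_≈_ S) (_≼_ S) f g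
  ⇀⇔covers f g = mk⇔ to from
    where
    to : _⇀_ S f g → Covers (_≈_ S) (_≼_ S) f g
    to f⇀g = (f⇀g ◅ ε , ⇀⁺⇒≉ {f} {g} {g} f⇀g ε) , no-middle
      where
      no-middle : ¬ ∃ λ h → (_≼_ S f h × ¬ _≈_ S f h) × (_≼_ S h g × ¬ _≈_ S h g)
      no-middle (h , (ε , f≉h) , _)                      = f≉h refl
      no-middle (h , _ , (ε , h≉g))                      = h≉g refl
      no-middle (h , (_◅_ {j = f₁} f⇀f₁ f₁≼h , _) , (_◅_ {j = h₁} h⇀h₁ h₁≼g , _)) =
        no-longer-path {f} {g} f⇀g {f₁} {h} {h₁} f⇀f₁ f₁≼h h⇀h₁ h₁≼g
    from : Covers (_≈_ S) (_≼_ S) f g → _⇀_ S f g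
    from ((ε , f≉g) , _)                       = ⊥-elim (f≉g refl)
    from ((f⇀g ◅ ε , _) , _)                   = f⇀g
    from ((_◅_ {j = h} f⇀h (_◅_ {j = h₁} h⇀h₁ h₁≼g) , _) , no-middle) =
      ⊥-elim (no-middle (h , (f⇀h ◅ ε , ⇀⁺⇒≉ {f} {h} {h} f⇀h ε) , (h⇀h₁ ◅ h₁≼g , ⇀⁺⇒≉ {h} {h₁} {g} h⇀h₁ h₁≼g)))

mainTheorem1 : (S : Signature) → Positive S →
    IsPartialOrder (_≈_ S) (_≼_ S) ×
    (∀ f g → (_⇀_ S f g) ⇔ Covers (_≈_ S) (_≼_ S) f g)
mainTheorem1 S _ = ForestOrder.≼-isPartialOrder S , ForestOrder.⇀⇔covers S
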